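{- The following graphs are single approval interval graphs: (1) the complete graphs $K_n$ for every positive integer $n$; (2) the cycles $C_n$ for every $n\ge3$; (3) the wheels $W_n$ for every $n\ge 3$; (4) all (finite) trees; (5) all complete $k$-partite graphs.
   Context: All graphs are finite and simple. The wheel $W_n$ is the graph on $n+1$ vertices obtained from the cycle $C_n$ by adding one vertex adjacent to all cycle vertices. An approval interval is a triple $I(a)=(a_l,a_a,a_r)$ of reals with $a_l<a_a<a_r$: the closed interval $[a_l,a_r]$ with approval mark $a_a$. A single approval interval representation of a graph $G$ assigns to each vertex $a$ an approval interval $I(a)$ such that distinct vertices $a,b$ are adjacent if and only if $[a_l,a_r]$ and $[b_l,b_r]$ intersect and their intersection contains exactly one of the two approval marks $a_a,b_a$. A graph is a single approval interval graph if it has such a representation. -}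

module Defs where

open import Data.Nat using (ℕ; zero; suc; _%_)
open import Data.Fin using (Fin; toℕ) renaming (zero to fzero; suc to fsuc)
open import Data.Rational using (ℚ; _≤_; _<_)
open import Data.Product using (Σ; ∃; _×_)
open import Data.Sum using (_⊎_)
open import Data.Empty using (⊥)
open import Data.Unit using (⊤)
open import Data.List using (List; []; _∷_; length)
open import Data.List.Relation.Unary.Unique.Propositional using (Unique)
open import Data.List.Relation.Unary.Linked using (Linked)
open import Relation.Nullary using (¬_)
open import Relation.Binary.PropositionalEquality using (_≡_; _≢_)
open import Function.Bundles using (_⇔_)

Rel : ℕ → Set₁
Rel n = Fin n → Fin n → Set

record Graph (n : ℕ) : Set₁ where
  field
    Adj    : Rel n
    symm   : ∀ {i j} → Adj i j → Adj j i
    irrefl : ∀ {i} → ¬ Adj i i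

record ApprovalInterval : Set where
  field
    l a r : ℚ
    l<a   : l < a
    a<r   : a < r

open ApprovalInterval public

_∈I_ : ℚ → ApprovalInterval → Set
x ∈I A = (l A ≤ x) × (x ≤ r A)

Intersect : ApprovalInterval → ApprovalInterval → Set
Intersect A B = ∃ λ x → (x ∈I A) × (x ∈I B)

MarkIn : ApprovalInterval → ApprovalInterval → Set
MarkIn A B = (a A ∈I A) × (a A ∈I B)

SAIEdge : ApprovalInterval → ApprovalInterval → Set
SAIEdge A B = Intersect A B ×
  ((MarkIn A B × ¬ MarkIn B A) ⊎ (¬ MarkIn A B × MarkIn B A))

IsSAIRep : (n : ℕ) → Rel n → (Fin n → ApprovalInterval) → Set
IsSAIRep n E I = ∀ u v → u ≢ v → (E u v ⇔ SAIEdge (I u) (I v))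

IsSAIGraph : (n : ℕ) → Rel n → Set
IsSAIGraph n E = Σ (Fin n → ApprovalInterval) (IsSAIRep n E)

CompleteAdj : (n : ℕ) → Rel n
CompleteAdj n i j = i ≢ j

CycleAdj : (n : ℕ) → Rel n
CycleAdj zero i j = ⊥
CycleAdj (suc m) i j =
  (toℕ j ≡ suc (toℕ i) % suc m) ⊎ (toℕ i ≡ suc (toℕ j) % suc m)

WheelAdj : (n : ℕ) → Rel (suc n)
WheelAdj n fzero fzero = ⊥
WheelAdj n fzero (fsuc j) = ⊤
WheelAdj n (fsuc i) fzero = ⊤
WheelAdj n (fsuc i) (fsuc j) = CycleAdj n i j

MultipartiteAdj : (n k : ℕ) → (Fin n → Fin k) → Rel n
MultipartiteAdj n k p i j = p i ≢ p j

data Walk {n : ℕ} (E : Rel n) : Fin n → Fin n → Set where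
  here : ∀ {u} → Walk E u u
  step : ∀ {u w v} → E u w → Walk E w v → Walk E u v

Connected : (n : ℕ) → Rel n → Set
Connected n E = ∀ u v → Walk E u v

lastOf : {A : Set} → A → List A → A
lastOf x [] = x
lastOf x (y ∷ ys) = lastOf y ys

HasCycle : (n : ℕ) → Rel n → Set
HasCycle n E = Σ (Fin n) λ x → Σ (List (Fin n)) λ xs →
  (2 Data.Nat.≤ length xs) × Unique (x ∷ xs) × Linked E (x ∷ xs) × E (lastOf x xs) x

IsTree : (n : ℕ) → Graph n → Set
IsTree n G = (1 Data.Nat.≤ n) × Connected n (Graph.Adj G) × ¬ HasCycle n (Graph.Adj G)

{-# OPTIONS --safe #-}
-- Give each vertex integer data lo ≤ pos ≤ hi, standing for the interval [lo, hi + 1] with mark pos + ½;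
-- two vertices are adjacent iff exactly one of them covers the mark of the other.
--
-- Complete multipartite graphs: part c gets lo = 0 and pos = hi = c, so u covers v iff part v ≤ part u, and
-- exactly one covers iff the parts differ.
--
-- Cycles: fold the cycle onto a line, out along the even positions and back along the odd ones, and let
-- each position reach one step left and two steps right, except that the turning positions 1 and m do not
-- reach left. Positions are then adjacent iff they are two apart or form a turning pair {0, 1}, {m − 1, m}.
-- A wheel adds a hub covering every rim mark whose own mark lies beyond every rim interval.
--
-- Trees: root the tree and code each vertex by its path to the root, read as a numeral in bijective base n.
-- With the mark at the code and the interval running from just above the parent's code to the largest code
-- of a child, exactly one of u, v covers the other iff one is the parent of the other. Paths to the root
-- are unique because the tree is acyclic.
module Submission where

open import Defs
open import Data.Nat as ℕ using (ℕ; zero; suc; pred; _+_; _*_; _≤_; _<_; s≤s; z≤n; _≟_; _%_)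
import Data.Nat.Properties as ℕ
open import Data.Nat.DivMod using (m<n⇒m%n≡m; n%n≡0)
open import Data.Nat.Tactic.RingSolver using (solve-∀)
import Data.Nat.Coprimality as Coprime
import Data.Integer as ℤ
import Data.Integer.Properties as ℤ
open import Data.Rational as ℚ using (ℚ; mkℚ; *≤*; *<*)
open import Data.Fin using (Fin; toℕ; zero; suc)
open import Data.Fin.Properties using (toℕ-injective; toℕ<n; toℕ≤pred[n]) renaming (_≟_ to _≟ᶠ_)
open import Data.List using (List; []; _∷_; _++_; [_]; length)
open import Data.List.Properties using (++-assoc; ∷-injectiveˡ; ∷-injectiveʳ)
open import Data.List.Relation.Unary.All using ([]; _∷_; lookup)
open import Data.List.Relation.Unary.All.Properties using (++⁻ˡ; ¬Any⇒All¬)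
open import Data.List.Relation.Unary.Any using (here; there)
open import Data.List.Relation.Unary.AllPairs using ([]; _∷_)
open import Data.List.Relation.Unary.Linked using (Linked; []; [-]; _∷_; head)
open import Data.List.Relation.Unary.Unique.Propositional using (Unique)
open import Data.List.Relation.Unary.Unique.Propositional.Properties using (Unique[x∷xs]⇒x∉xs)
open import Data.List.Membership.Propositional using (_∈_; _∉_)
open import Data.List.Membership.Propositional.Properties using (∈-∃++; ∈-++⁺ʳ)
import Data.List.Membership.DecPropositional as DecMembership
open import Data.Empty using (⊥; ⊥-elim)
open import Data.Unit using (tt)
open import Data.Product using (_×_; _,_; proj₂)
open import Data.Product.Function.NonDependent.Propositional using (_×-⇔_)
open import Data.Sum using (_⊎_; inj₁; inj₂; swap)
open import Data.Sum.Function.Propositional using (_⊎-⇔_)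
open import Function using (_∘_; id)
open import Function.Bundles using (_⇔_; mk⇔; Equivalence)
import Function.Properties.Equivalence as ⇔
open import Function.Related.TypeIsomorphisms using (¬-cong-⇔)
open import Relation.Nullary using (¬_; Dec; yes; no; contradiction)
open import Relation.Nullary.Decidable using (_⊎-dec_)
open import Relation.Binary.Definitions using (tri<; tri≈; tri>)
open import Relation.Binary.PropositionalEquality
  using (_≡_; _≢_; refl; sym; trans; cong; cong₂; subst; subst₂)

Xor : Set → Set → Set
Xor P Q = (P × ¬ Q) ⊎ (¬ P × Q)

xor-swap : ∀ {P Q} → Xor P Q → Xor Q P
xor-swap (inj₁ (p , ¬q)) = inj₂ (¬q , p)
xor-swap (inj₂ (¬p , q)) = inj₁ (q , ¬p)

xor-irrefl : ∀ {P} → ¬ Xor P P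
xor-irrefl (inj₁ (p , ¬p)) = ¬p p
xor-irrefl (inj₂ (¬p , p)) = ¬p p

xor-comm : ∀ {P Q} → Xor P Q ⇔ Xor Q P
xor-comm = mk⇔ xor-swap xor-swap

xor-cong : ∀ {P P′ Q Q′} → P ⇔ P′ → Q ⇔ Q′ → Xor P Q ⇔ Xor P′ Q′
xor-cong p q = (p ×-⇔ ¬-cong-⇔ q) ⊎-⇔ (¬-cong-⇔ p ×-⇔ q)

saiEdge⇔xorMarkIn : ∀ X Y → SAIEdge X Y ⇔ Xor (MarkIn X Y) (MarkIn Y X)
saiEdge⇔xorMarkIn X Y = mk⇔ proj₂ λ x → intersect x , x
  where
  intersect : Xor (MarkIn X Y) (MarkIn Y X) → Intersect X Y
  intersect (inj₁ (x∈ , _)) = a X , x∈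
  intersect (inj₂ (_ , (y∈Y , y∈X))) = a Y , y∈X , y∈Y

record Reach : Set where
  constructor reach
  field
    lo pos hi : ℕ
    lo≤pos    : lo ≤ pos
    pos≤hi    : pos ≤ hi

open Reach

Covers : Reach → Reach → Set
Covers A B = lo A ≤ pos B × pos B ≤ hi A

CoverAdj : Reach → Reach → Set
CoverAdj A B = Xor (Covers A B) (Covers B A)

fromℕ : ℕ → ℚ
fromℕ k = mkℚ (ℤ.+ k) 0 (Coprime.sym (Coprime.1-coprimeTo k))

fromℕ-mono-≤ : ∀ {j k} → j ≤ k → fromℕ j ℚ.≤ fromℕ k
fromℕ-mono-≤ {j} {k} j≤k =
  *≤* (subst₂ ℤ._≤_ (sym (ℤ.*-identityʳ (ℤ.+ j))) (sym (ℤ.*-identityʳ (ℤ.+ k))) (ℤ.+≤+ j≤k))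

fromℕ-mono-< : ∀ {j k} → j < k → fromℕ j ℚ.< fromℕ k
fromℕ-mono-< {j} {k} j<k =
  *<* (subst₂ ℤ._<_ (sym (ℤ.*-identityʳ (ℤ.+ j))) (sym (ℤ.*-identityʳ (ℤ.+ k))) (ℤ.+<+ j<k))

fromℕ-cancel-≤ : ∀ {j k} → fromℕ j ℚ.≤ fromℕ k → j ≤ k
fromℕ-cancel-≤ {j} {k} (*≤* le) =
  ℤ.drop‿+≤+ (subst₂ ℤ._≤_ (ℤ.*-identityʳ (ℤ.+ j)) (ℤ.*-identityʳ (ℤ.+ k)) le)

fromℕ-≤⇔ : ∀ {j k} → fromℕ j ℚ.≤ fromℕ k ⇔ j ≤ k
fromℕ-≤⇔ = mk⇔ fromℕ-cancel-≤ fromℕ-mono-≤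

double-≤-odd⇔ : ∀ {m n} → 2 * m ≤ suc (2 * n) ⇔ m ≤ n
double-≤-odd⇔ {m} {n} = mk⇔ cancel (ℕ.m≤n⇒m≤1+n ∘ ℕ.*-monoʳ-≤ 2)
  where
  cancel : 2 * m ≤ suc (2 * n) → m ≤ n
  cancel le = ℕ.≮⇒≥ λ n<m → ℕ.<⇒≱ (subst (_≤ 2 * m) (ℕ.*-suc 2 n) (ℕ.*-monoʳ-≤ 2 n<m)) le

toApproval : Reach → ApprovalInterval
toApproval A = record
  { l = fromℕ (2 * lo A) ; a = fromℕ (suc (2 * pos A)) ; r = fromℕ (2 * suc (hi A))
  ; l<a = fromℕ-mono-< (s≤s (ℕ.*-monoʳ-≤ 2 (lo≤pos A)))
  ; a<r = fromℕ-mono-< (subst (suc (suc (2 * pos A)) ≤_) (sym (ℕ.*-suc 2 (hi A)))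
                                  (s≤s (s≤s (ℕ.*-monoʳ-≤ 2 (pos≤hi A))))) }

mark∈⇔covers : ∀ A B → a (toApproval A) ∈I toApproval B ⇔ Covers B A
mark∈⇔covers A B = ⇔.trans fromℕ-≤⇔ double-≤-odd⇔ ×-⇔ ⇔.trans fromℕ-≤⇔ odd≤⇔
  where
  odd≤⇔ : suc (2 * pos A) ≤ 2 * suc (hi B) ⇔ pos A ≤ hi B
  odd≤⇔ = ⇔.trans (mk⇔ (λ le → ℕ.≤-pred (subst (suc (2 * pos A) ≤_) (ℕ.*-suc 2 (hi B)) le))
                       (λ le → subst (suc (2 * pos A) ≤_) (sym (ℕ.*-suc 2 (hi B))) (s≤s le)))
                  double-≤-odd⇔

covers-self : ∀ A → Covers A A
covers-self A = lo≤pos A , pos≤hi A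

markIn⇔covers : ∀ A B → MarkIn (toApproval A) (toApproval B) ⇔ Covers B A
markIn⇔covers A B = mk⇔ (Equivalence.to (mark∈⇔covers A B) ∘ proj₂) λ c →
  Equivalence.from (mark∈⇔covers A A) (covers-self A) , Equivalence.from (mark∈⇔covers A B) c

saiEdge⇔coverAdj : ∀ A B → SAIEdge (toApproval A) (toApproval B) ⇔ CoverAdj A B
saiEdge⇔coverAdj A B = ⇔.trans (saiEdge⇔xorMarkIn (toApproval A) (toApproval B))
  (⇔.trans (xor-cong (markIn⇔covers A B) (markIn⇔covers B A)) xor-comm)

reach-representation : ∀ {n} {E : Rel n} (R : Fin n → Reach) →
                       (∀ u v → u ≢ v → E u v ⇔ CoverAdj (R u) (R v)) → IsSAIGraph n E
reach-representation R rep =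
  toApproval ∘ R , λ u v u≢v → ⇔.trans (rep u v u≢v) (⇔.sym (saiEdge⇔coverAdj (R u) (R v)))

xor-≤⇔≢ : ∀ {m n} → Xor (n ≤ m) (m ≤ n) ⇔ m ≢ n
xor-≤⇔≢ {m} {n} = mk⇔ to from
  where
  to : Xor (n ≤ m) (m ≤ n) → m ≢ n
  to (inj₁ (_ , m≰n)) refl = m≰n ℕ.≤-refl
  to (inj₂ (n≰m , _)) refl = n≰m ℕ.≤-refl
  from : m ≢ n → Xor (n ≤ m) (m ≤ n)
  from m≢n with ℕ.<-cmp m n
  ... | tri< m<n _ _ = inj₂ (ℕ.<⇒≱ m<n , ℕ.<⇒≤ m<n)
  ... | tri≈ _ m≡n _ = contradiction m≡n m≢n
  ... | tri> _ _ n<m = inj₁ (ℕ.<⇒≤ n<m , ℕ.<⇒≱ n<m)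

partReach : ℕ → Reach
partReach c = reach 0 c c z≤n ℕ.≤-refl

partReach-adj⇔≢ : ∀ c d → CoverAdj (partReach c) (partReach d) ⇔ c ≢ d
partReach-adj⇔≢ c d = ⇔.trans (xor-cong bound-irrelevant bound-irrelevant) xor-≤⇔≢
  where
  bound-irrelevant : ∀ {i j} → (0 ≤ i × i ≤ j) ⇔ i ≤ j
  bound-irrelevant = mk⇔ proj₂ (z≤n ,_)

multipartite : (n k : ℕ) (p : Fin n → Fin k) → IsSAIGraph n (MultipartiteAdj n k p)
multipartite n k p = reach-representation (partReach ∘ toℕ ∘ p) λ u v _ →
  ⇔.trans (¬-cong-⇔ (mk⇔ (cong toℕ) toℕ-injective))
          (⇔.sym (partReach-adj⇔≢ (toℕ (p u)) (toℕ (p v))))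

complete : (n : ℕ) → IsSAIGraph n (CompleteAdj n)
complete n = multipartite n n id

+-≡-max : ∀ {a b m} → a ≤ m → b ≤ m → a + b ≡ m + m → a ≡ m
+-≡-max a≤m b≤m eq = ℕ.≤-antisym a≤m (ℕ.≮⇒≥ λ a<m → ℕ.<-irrefl eq (ℕ.+-mono-<-≤ a<m b≤m))

pred≤⇒≤suc : ∀ {p q} → p < q → pred q ≤ p → q ≤ suc p
pred≤⇒≤suc (s≤s _) le = s≤s le

<∧+≡1 : ∀ {p q} → p < q → p + q ≡ 1 → p ≡ 0 × q ≡ 1
<∧+≡1 {zero} _ q≡1 = refl , q≡1
<∧+≡1 {suc p} {suc q} _ eq = contradiction (ℕ.suc-injective eq) (ℕ.m+1+n≢0 p)

double : ∀ m → m + m ≡ 2 * m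
double m = cong (m +_) (sym (ℕ.+-identityʳ m))

odd+odd≡even : ∀ a b → suc (2 * a) + suc (2 * b) ≡ 2 * suc (a + b)
odd+odd≡even = solve-∀

2+even≡even : ∀ x → 2 + 2 * x ≡ 2 * suc x
2+even≡even x = sym (ℕ.*-suc 2 x)

double-injective : ∀ {x y} → 2 * x ≡ 2 * y → x ≡ y
double-injective {x} {y} = ℕ.*-cancelˡ-≡ x y 2

module _ (m : ℕ) where

  IsTurn : ℕ → Set
  IsTurn p = p ≡ 1 ⊎ p ≡ m

  turn? : ∀ p → Dec (IsTurn p)
  turn? p = p ≟ 1 ⊎-dec p ≟ m

  foldLo : ℕ → ℕ
  foldLo p with turn? p
  ... | yes _ = p
  ... | no _  = pred p

  foldLo≤ : ∀ p → foldLo p ≤ p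
  foldLo≤ p with turn? p
  ... | yes _ = ℕ.≤-refl
  ... | no _  = ℕ.pred[n]≤n

  foldReach : ℕ → Reach
  foldReach p = reach (foldLo p) p (2 + p) (foldLo≤ p) (ℕ.m≤n+m p 2)

  -- For p, q ≤ m the last two disjuncts say {p, q} = {0, 1} and {p, q} = {m − 1, m}.
  FoldAdj : ℕ → ℕ → Set
  FoldAdj p q = (2 + p ≡ q ⊎ 2 + q ≡ p) ⊎ (p + q ≡ 1 ⊎ suc (p + q) ≡ 2 * m)

  FoldStep : ℕ → ℕ → Set
  FoldStep p q = q ≡ 2 + p ⊎ (q ≡ suc p × IsTurn q)

  covers-up⇔ : ∀ {p q} → p < q → Covers (foldReach p) (foldReach q) ⇔ q ≤ 2 + p
  covers-up⇔ {p} p<q = mk⇔ proj₂ (ℕ.≤-trans (foldLo≤ p) (ℕ.<⇒≤ p<q) ,_)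

  covers-down⇔ : ∀ {p q} → p < q → Covers (foldReach q) (foldReach p) ⇔ (q ≡ suc p × ¬ IsTurn q)
  covers-down⇔ {p} {q} p<q = mk⇔ to from
    where
    to : Covers (foldReach q) (foldReach p) → q ≡ suc p × ¬ IsTurn q
    to (lo≤p , _) with turn? q
    ... | yes _    = contradiction lo≤p (ℕ.<⇒≱ p<q)
    ... | no ¬turn = ℕ.≤-antisym (pred≤⇒≤suc p<q lo≤p) p<q , ¬turn
    from : q ≡ suc p × ¬ IsTurn q → Covers (foldReach q) (foldReach p)
    from (refl , ¬turn) with turn? q
    ... | yes turn = contradiction turn ¬turn
    ... | no _     = ℕ.≤-refl , ℕ.m≤n+m p 3

  coverAdj⇔foldStep : ∀ {p q} → p < q → CoverAdj (foldReach p) (foldReach q) ⇔ FoldStep p q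
  coverAdj⇔foldStep {p} {q} p<q = ⇔.trans (xor-cong (covers-up⇔ p<q) (covers-down⇔ p<q)) (mk⇔ to from)
    where
    to : Xor (q ≤ 2 + p) (q ≡ suc p × ¬ IsTurn q) → FoldStep p q
    to (inj₁ (q≤2+p , ¬close)) with ℕ.m≤n⇒m<n∨m≡n q≤2+p
    ... | inj₂ q≡2+p = inj₁ q≡2+p
    ... | inj₁ q<2+p with turn? q
    ...   | yes turn = inj₂ (ℕ.≤-antisym (ℕ.≤-pred q<2+p) p<q , turn)
    ...   | no ¬turn = contradiction (ℕ.≤-antisym (ℕ.≤-pred q<2+p) p<q , ¬turn) ¬close
    to (inj₂ (q≰2+p , (refl , _))) = contradiction (ℕ.n≤1+n q) q≰2+p
    from : FoldStep p q → Xor (q ≤ 2 + p) (q ≡ suc p × ¬ IsTurn q)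
    from (inj₁ refl) = inj₁ (ℕ.≤-refl , λ (eq , _) → ℕ.<-irrefl (sym eq) (ℕ.n<1+n (suc p)))
    from (inj₂ (refl , turn)) = inj₁ (ℕ.n≤1+n q , λ (_ , ¬turn) → ¬turn turn)

  foldStep⇔foldAdj : ∀ {p q} → p < q → q ≤ m → FoldStep p q ⇔ FoldAdj p q
  foldStep⇔foldAdj {p} {q} p<q q≤m = mk⇔ to from
    where
    to : FoldStep p q → FoldAdj p q
    to (inj₁ refl) = inj₁ (inj₁ refl)
    to (inj₂ (refl , inj₁ refl)) = inj₂ (inj₁ refl)
    to (inj₂ (refl , inj₂ refl)) = inj₂ (inj₂ (double (suc p)))
    from : FoldAdj p q → FoldStep p q
    from (inj₁ (inj₁ refl)) = inj₁ refl
    from (inj₁ (inj₂ refl)) = contradiction p<q (ℕ.≤⇒≯ (ℕ.m≤n+m q 2))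
    from (inj₂ (inj₁ p+q≡1)) with refl , refl ← <∧+≡1 p<q p+q≡1 = inj₂ (refl , inj₁ refl)
    from (inj₂ (inj₂ eq)) = inj₂ (trans q≡m (sym 1+p≡m) , inj₂ q≡m)
      where
      eq′ : suc p + q ≡ m + m
      eq′ = trans eq (sym (double m))
      1+p≡m : suc p ≡ m
      1+p≡m = +-≡-max (ℕ.≤-trans p<q q≤m) q≤m eq′
      q≡m : q ≡ m
      q≡m = +-≡-max q≤m (ℕ.≤-trans p<q q≤m) (trans (ℕ.+-comm q (suc p)) eq′)

  foldAdj-sym : ∀ {p q} → FoldAdj p q → FoldAdj q p
  foldAdj-sym (inj₁ (inj₁ e)) = inj₁ (inj₂ e)
  foldAdj-sym (inj₁ (inj₂ e)) = inj₁ (inj₁ e)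
  foldAdj-sym {p} {q} (inj₂ (inj₁ e)) = inj₂ (inj₁ (trans (ℕ.+-comm q p) e))
  foldAdj-sym {p} {q} (inj₂ (inj₂ e)) = inj₂ (inj₂ (trans (cong suc (ℕ.+-comm q p)) e))

  foldAdj-comm : ∀ {p q} → FoldAdj p q ⇔ FoldAdj q p
  foldAdj-comm = mk⇔ foldAdj-sym foldAdj-sym

  foldAdj-irrefl : ∀ p → ¬ FoldAdj p p
  foldAdj-irrefl p (inj₁ (inj₁ e)) = ℕ.<-irrefl (sym e) (ℕ.m<n+m p (s≤s z≤n))
  foldAdj-irrefl p (inj₁ (inj₂ e)) = ℕ.<-irrefl (sym e) (ℕ.m<n+m p (s≤s z≤n))
  foldAdj-irrefl p (inj₂ (inj₁ e)) = ℕ.even≢odd p 0 (trans (sym (double p)) e)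
  foldAdj-irrefl p (inj₂ (inj₂ e)) = ℕ.even≢odd m p (sym (trans (cong suc (sym (double p))) e))

  foldReach-adj⇔ : ∀ {p q} → p ≤ m → q ≤ m → CoverAdj (foldReach p) (foldReach q) ⇔ FoldAdj p q
  foldReach-adj⇔ {p} {q} p≤m q≤m with ℕ.<-cmp p q
  ... | tri< p<q _ _ = ⇔.trans (coverAdj⇔foldStep p<q) (foldStep⇔foldAdj p<q q≤m)
  ... | tri≈ _ refl _ = mk⇔ (⊥-elim ∘ xor-irrefl) (⊥-elim ∘ foldAdj-irrefl p)
  ... | tri> _ _ q<p = ⇔.trans xor-comm (⇔.trans (coverAdj⇔foldStep q<p)
                         (⇔.trans (foldStep⇔foldAdj q<p p≤m) foldAdj-comm))

  foldAdj-even⇔ : ∀ {x y} → FoldAdj (2 * x) (2 * y) ⇔ (y ≡ suc x ⊎ x ≡ suc y)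
  foldAdj-even⇔ {x} {y} = mk⇔ to from
    where
    to : FoldAdj (2 * x) (2 * y) → y ≡ suc x ⊎ x ≡ suc y
    to (inj₁ (inj₁ e)) = inj₁ (double-injective (sym (trans (sym (2+even≡even x)) e)))
    to (inj₁ (inj₂ e)) = inj₂ (double-injective (sym (trans (sym (2+even≡even y)) e)))
    to (inj₂ (inj₁ e)) = contradiction (trans (ℕ.*-distribˡ-+ 2 x y) e) (ℕ.even≢odd (x + y) 0)
    to (inj₂ (inj₂ e)) = contradiction (sym (trans (cong suc (ℕ.*-distribˡ-+ 2 x y)) e))
                                       (ℕ.even≢odd m (x + y))
    from : y ≡ suc x ⊎ x ≡ suc y → FoldAdj (2 * x) (2 * y)
    from (inj₁ refl) = inj₁ (inj₁ (2+even≡even x))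
    from (inj₂ refl) = inj₁ (inj₂ (2+even≡even y))

  foldAdj-odd⇔ : ∀ {a b} → FoldAdj (suc (2 * a)) (suc (2 * b)) ⇔ (b ≡ suc a ⊎ a ≡ suc b)
  foldAdj-odd⇔ {a} {b} = mk⇔ to from
    where
    to : FoldAdj (suc (2 * a)) (suc (2 * b)) → b ≡ suc a ⊎ a ≡ suc b
    to (inj₁ (inj₁ e)) = inj₁ (double-injective (sym (trans (sym (2+even≡even a)) (ℕ.suc-injective e))))
    to (inj₁ (inj₂ e)) = inj₂ (double-injective (sym (trans (sym (2+even≡even b)) (ℕ.suc-injective e))))
    to (inj₂ (inj₁ e)) = contradiction (ℕ.suc-injective e) (ℕ.m+1+n≢0 (2 * a))
    to (inj₂ (inj₂ e)) = contradiction (sym (trans (cong suc (sym (odd+odd≡even a b))) e))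
                                       (ℕ.even≢odd m (suc (a + b)))
    from : b ≡ suc a ⊎ a ≡ suc b → FoldAdj (suc (2 * a)) (suc (2 * b))
    from (inj₁ refl) = inj₁ (inj₁ (cong suc (2+even≡even a)))
    from (inj₂ refl) = inj₁ (inj₂ (cong suc (2+even≡even b)))

  foldAdj-even-odd⇔ : ∀ {x b} → FoldAdj (2 * x) (suc (2 * b)) ⇔ ((x ≡ 0 × b ≡ 0) ⊎ suc (x + b) ≡ m)
  foldAdj-even-odd⇔ {x} {b} = mk⇔ to from
    where
    to : FoldAdj (2 * x) (suc (2 * b)) → (x ≡ 0 × b ≡ 0) ⊎ suc (x + b) ≡ m
    to (inj₁ (inj₁ e)) = contradiction (trans (sym (2+even≡even x)) e) (ℕ.even≢odd (suc x) b)
    to (inj₁ (inj₂ e)) = contradiction (sym (trans (cong suc (sym (2+even≡even b))) e))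
                                       (ℕ.even≢odd x (suc b))
    to (inj₂ (inj₁ e)) = inj₁ ( double-injective (ℕ.m+n≡0⇒m≡0 (2 * x) 2x+2b≡0)
                              , double-injective (ℕ.m+n≡0⇒n≡0 (2 * x) 2x+2b≡0))
      where
      2x+2b≡0 : 2 * x + 2 * b ≡ 0
      2x+2b≡0 = ℕ.suc-injective (trans (sym (ℕ.+-suc (2 * x) (2 * b))) e)
    to (inj₂ (inj₂ e)) = inj₂ (double-injective (trans (sym (odd+odd≡even x b)) e))
    from : (x ≡ 0 × b ≡ 0) ⊎ suc (x + b) ≡ m → FoldAdj (2 * x) (suc (2 * b))
    from (inj₁ (refl , refl)) = inj₂ (inj₁ refl)
    from (inj₂ refl) = inj₂ (inj₂ (odd+odd≡even x b))

  CycleSucc : ℕ → ℕ → Set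
  CycleSucc x y = y ≡ suc x ⊎ (x ≡ m × y ≡ 0)

  CycleAdjℕ : ℕ → ℕ → Set
  CycleAdjℕ x y = CycleSucc x y ⊎ CycleSucc y x

  cycleAdj-comm : ∀ {x y} → CycleAdjℕ x y ⇔ CycleAdjℕ y x
  cycleAdj-comm = mk⇔ swap swap

  front≢m : ∀ {x} → 0 < m → 2 * x ≤ m → x ≢ m
  front≢m 0<m 2m≤m refl = ℕ.<⇒≱ (subst (m <_) (double m) (ℕ.m<m+n m 0<m)) 2m≤m

  back≢0 : ∀ {x} → m < 2 * x → x ≢ 0
  back≢0 m<0 refl = ℕ.n≮0 m<0

  complement-step : ∀ {a b x y} → a + x ≡ m → b + y ≡ m → b ≡ suc a ⇔ x ≡ suc y
  complement-step {a} {b} {x} {y} a+x≡m b+y≡m = mk⇔ to from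
    where
    to : b ≡ suc a → x ≡ suc y
    to refl = sym (ℕ.+-cancelˡ-≡ a (suc y) x (trans (ℕ.+-suc a y) (trans b+y≡m (sym a+x≡m))))
    from : x ≡ suc y → b ≡ suc a
    from refl = sym (ℕ.+-cancelʳ-≡ y (suc a) b (trans (sym (ℕ.+-suc a y)) (trans a+x≡m (sym b+y≡m))))

  cycleAdj⇔succ : ∀ {x y} → ¬ (x ≡ m × y ≡ 0) → ¬ (y ≡ m × x ≡ 0) →
                  CycleAdjℕ x y ⇔ (y ≡ suc x ⊎ x ≡ suc y)
  cycleAdj⇔succ {x} {y} ¬wrap ¬wrap′ = mk⇔ to from
    where
    to : CycleAdjℕ x y → y ≡ suc x ⊎ x ≡ suc y
    to (inj₁ (inj₁ e)) = inj₁ e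
    to (inj₁ (inj₂ w)) = contradiction w ¬wrap
    to (inj₂ (inj₁ e)) = inj₂ e
    to (inj₂ (inj₂ w)) = contradiction w ¬wrap′
    from : y ≡ suc x ⊎ x ≡ suc y → CycleAdjℕ x y
    from (inj₁ e) = inj₁ (inj₁ e)
    from (inj₂ e) = inj₂ (inj₁ e)

  cycleAdj-front-back⇔ : ∀ {x y b} → 0 < m → 2 * x ≤ m → b + y ≡ m → m < 2 * y →
                         CycleAdjℕ x y ⇔ ((x ≡ 0 × b ≡ 0) ⊎ suc (x + b) ≡ m)
  cycleAdj-front-back⇔ {x} {y} {b} 0<m front b+y≡m back = mk⇔ to from
    where
    x<y : x < y
    x<y = ℕ.*-cancelˡ-< 2 x y (ℕ.≤-<-trans front back)
    to : CycleAdjℕ x y → (x ≡ 0 × b ≡ 0) ⊎ suc (x + b) ≡ m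
    to (inj₁ (inj₁ refl)) = inj₂ (trans (ℕ.+-comm (suc x) b) b+y≡m)
    to (inj₁ (inj₂ (x≡m , _))) = contradiction x≡m (front≢m 0<m front)
    to (inj₂ (inj₁ refl)) = contradiction x<y (ℕ.<-asym (ℕ.n<1+n y))
    to (inj₂ (inj₂ (refl , x≡0))) = inj₁ (x≡0 , ℕ.+-cancelʳ-≡ y b 0 b+y≡m)
    from : (x ≡ 0 × b ≡ 0) ⊎ suc (x + b) ≡ m → CycleAdjℕ x y
    from (inj₁ (refl , refl)) = inj₂ (inj₂ (b+y≡m , refl))
    from (inj₂ e) =
      inj₁ (inj₁ (ℕ.+-cancelˡ-≡ b y (suc x) (trans b+y≡m (sym (trans (ℕ.+-comm b (suc x)) e)))))

  data Half (x : ℕ) : ℕ → Set where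
    front : 2 * x ≤ m → Half x (2 * x)
    back  : ∀ {a} → a + x ≡ m → m < 2 * x → Half x (suc (2 * a))

  foldPos : ℕ → ℕ
  foldPos x with 2 * x ℕ.≤? m
  ... | yes _ = 2 * x
  ... | no _  = suc (2 * (m ℕ.∸ x))

  half : ∀ {x} → x ≤ m → Half x (foldPos x)
  half {x} x≤m with 2 * x ℕ.≤? m
  ... | yes 2x≤m = front 2x≤m
  ... | no 2x≰m  = back (ℕ.m∸n+n≡m x≤m) (ℕ.≰⇒> 2x≰m)

  half≤ : ∀ {x p} → Half x p → p ≤ m
  half≤ (front 2x≤m) = 2x≤m
  half≤ {x} (back {a} a+x≡m m<2x) = ℕ.+-cancelʳ-≤ m (suc (2 * a)) m (begin
    suc (2 * a) + m   ≡⟨ sym (ℕ.+-suc (2 * a) m) ⟩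
    2 * a + suc m     ≤⟨ ℕ.+-monoʳ-≤ (2 * a) m<2x ⟩
    2 * a + 2 * x     ≡⟨ sym (ℕ.*-distribˡ-+ 2 a x) ⟩
    2 * (a + x)       ≡⟨ cong (2 *_) a+x≡m ⟩
    2 * m             ≡⟨ sym (double m) ⟩
    m + m             ∎)
    where open ℕ.≤-Reasoning

  cycleAdj⇔foldAdj : ∀ {x y} → 0 < m → x ≤ m → y ≤ m →
                     CycleAdjℕ x y ⇔ FoldAdj (foldPos x) (foldPos y)
  cycleAdj⇔foldAdj {x} {y} 0<m x≤m y≤m with foldPos x | half x≤m | foldPos y | half y≤m
  ... | _ | front fx | _ | front fy =
    ⇔.trans (cycleAdj⇔succ (λ (x≡m , _) → front≢m 0<m fx x≡m) (λ (y≡m , _) → front≢m 0<m fy y≡m))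
            (⇔.sym foldAdj-even⇔)
  ... | _ | back ax bx | _ | back ay by =
    ⇔.trans (cycleAdj⇔succ (λ (_ , y≡0) → back≢0 by y≡0) (λ (_ , x≡0) → back≢0 bx x≡0))
            (⇔.trans (⇔.sym (complement-step ay ax) ⊎-⇔ ⇔.sym (complement-step ax ay))
                     (⇔.trans (mk⇔ swap swap) (⇔.sym foldAdj-odd⇔)))
  ... | _ | front fx | _ | back ay by =
    ⇔.trans (cycleAdj-front-back⇔ 0<m fx ay by) (⇔.sym foldAdj-even-odd⇔)
  ... | _ | back ax bx | _ | front fy =
    ⇔.trans cycleAdj-comm (⇔.trans (cycleAdj-front-back⇔ 0<m fy ax bx)
                                   (⇔.trans (⇔.sym foldAdj-even-odd⇔) foldAdj-comm))

  foldPos≤ : ∀ {x} → x ≤ m → foldPos x ≤ m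
  foldPos≤ = half≤ ∘ half

  succMod⇔cycleSucc : ∀ {x y} → x ≤ m → y ≤ m → (y ≡ suc x % suc m) ⇔ CycleSucc x y
  succMod⇔cycleSucc {x} {y} x≤m y≤m with ℕ.m≤n⇒m<n∨m≡n x≤m
  ... | inj₁ x<m rewrite m<n⇒m%n≡m (s≤s x<m) = mk⇔ inj₁ λ where
    (inj₁ e) → e
    (inj₂ (x≡m , _)) → contradiction x≡m (ℕ.<⇒≢ x<m)
  ... | inj₂ refl rewrite n%n≡0 (suc x) ⦃ _ ⦄ = mk⇔ (λ y≡0 → inj₂ (refl , y≡0)) λ where
    (inj₁ refl) → contradiction y≤m ℕ.1+n≰n
    (inj₂ (_ , y≡0)) → y≡0

cycleReach : (m : ℕ) → Fin (suc m) → Reach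
cycleReach m i = foldReach m (foldPos m (toℕ i))

cycleReach-adj⇔ : ∀ {m} → 0 < m → (i j : Fin (suc m)) →
                  CycleAdj (suc m) i j ⇔ CoverAdj (cycleReach m i) (cycleReach m j)
cycleReach-adj⇔ {m} 0<m i j =
  ⇔.trans (succMod⇔cycleSucc m i≤m j≤m ⊎-⇔ succMod⇔cycleSucc m j≤m i≤m)
  (⇔.trans (cycleAdj⇔foldAdj m 0<m i≤m j≤m)
           (⇔.sym (foldReach-adj⇔ m (foldPos≤ m i≤m) (foldPos≤ m j≤m))))
  where
  i≤m : toℕ i ≤ m
  i≤m = toℕ≤pred[n] i
  j≤m : toℕ j ≤ m
  j≤m = toℕ≤pred[n] j

cycle : (n : ℕ) → 2 ≤ n → IsSAIGraph n (CycleAdj n)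
cycle (suc m) (s≤s 0<m) = reach-representation (cycleReach m) λ i j _ → cycleReach-adj⇔ 0<m i j

wheel : (n : ℕ) → 2 ≤ n → IsSAIGraph (suc n) (WheelAdj n)
wheel (suc m) (s≤s 0<m) = reach-representation wheelReach adj
  where
  hub : Reach
  hub = reach 0 (3 + m) (3 + m) z≤n ℕ.≤-refl
  wheelReach : Fin (suc (suc m)) → Reach
  wheelReach zero    = hub
  wheelReach (suc i) = cycleReach m i
  hub-adj : ∀ i → CoverAdj hub (cycleReach m i)
  hub-adj i = inj₁ ( (z≤n , ℕ.m≤n⇒m≤o+n 3 p≤m)
                   , λ (_ , hub≤rim) → ℕ.<⇒≱ (s≤s (s≤s (s≤s p≤m))) hub≤rim)
    where
    p≤m : foldPos m (toℕ i) ≤ m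
    p≤m = foldPos≤ m (toℕ≤pred[n] i)
  adj : ∀ u v → u ≢ v → WheelAdj (suc m) u v ⇔ CoverAdj (wheelReach u) (wheelReach v)
  adj zero    zero    u≢v = contradiction refl u≢v
  adj zero    (suc j) _   = mk⇔ (λ _ → hub-adj j) (λ _ → tt)
  adj (suc i) zero    _   = mk⇔ (λ _ → xor-swap (hub-adj i)) (λ _ → tt)
  adj (suc i) (suc j) _   = cycleReach-adj⇔ 0<m i j

xor-interleave⇔ : ∀ {q₁ n₁ q₂ n₂} → q₁ < n₁ → q₂ < n₂ →
                  Xor (q₁ < n₂ × q₂ ≤ n₁) (q₂ < n₁ × q₁ ≤ n₂) ⇔ (q₂ ≡ n₁ ⊎ q₁ ≡ n₂)
xor-interleave⇔ {q₁} {n₁} {q₂} {n₂} q₁<n₁ q₂<n₂ = mk⇔ to from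
  where
  to : Xor (q₁ < n₂ × q₂ ≤ n₁) (q₂ < n₁ × q₁ ≤ n₂) → q₂ ≡ n₁ ⊎ q₁ ≡ n₂
  to (inj₁ ((q₁<n₂ , q₂≤n₁) , ¬cover)) =
    inj₁ (ℕ.≤-antisym q₂≤n₁ (ℕ.≮⇒≥ λ q₂<n₁ → ¬cover (q₂<n₁ , ℕ.<⇒≤ q₁<n₂)))
  to (inj₂ (¬cover , (q₂<n₁ , q₁≤n₂))) =
    inj₂ (ℕ.≤-antisym q₁≤n₂ (ℕ.≮⇒≥ λ q₁<n₂ → ¬cover (q₁<n₂ , ℕ.<⇒≤ q₂<n₁)))
  from : q₂ ≡ n₁ ⊎ q₁ ≡ n₂ → Xor (q₁ < n₂ × q₂ ≤ n₁) (q₂ < n₁ × q₁ ≤ n₂)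
  from (inj₁ refl) = inj₁ ((ℕ.<-trans q₁<n₁ q₂<n₂ , ℕ.≤-refl) , λ (q₂<q₂ , _) → ℕ.n≮n _ q₂<q₂)
  from (inj₂ refl) = inj₂ ((λ (q₁<q₁ , _) → ℕ.n≮n _ q₁<q₁) , (ℕ.<-trans q₂<n₂ q₁<n₁ , ℕ.≤-refl))

-- Lists over Fin n as numerals in bijective base n, with digits 1, …, n.
code : ∀ {n} → List (Fin n) → ℕ
code []           = 0
code {n} (v ∷ vs) = n * code vs + suc (toℕ v)

digit-≤⇔ : ∀ {n a b i} → i < n → n * a + suc i ≤ n * b + n ⇔ a ≤ b
digit-≤⇔ {n} {a} {b} {i} i<n = mk⇔ to (λ a≤b → ℕ.+-mono-≤ (ℕ.*-monoʳ-≤ n a≤b) i<n)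
  where
  to : n * a + suc i ≤ n * b + n → a ≤ b
  to le = ℕ.≮⇒≥ λ b<a → ℕ.<⇒≱ (begin-strict
    n * b + n       ≡⟨ ℕ.+-comm (n * b) n ⟩
    n + n * b       ≡⟨ sym (ℕ.*-suc n b) ⟩
    n * suc b       ≤⟨ ℕ.*-monoʳ-≤ n b<a ⟩
    n * a           <⟨ ℕ.m<m+n (n * a) (s≤s z≤n) ⟩
    n * a + suc i   ∎) le
    where open ℕ.≤-Reasoning

digit-injective : ∀ {n a b i j} → i < n → j < n → n * a + suc i ≡ n * b + suc j → a ≡ b × i ≡ j
digit-injective {n} {a} {b} {i} {j} i<n j<n eq with ℕ.<-cmp a b
... | tri< a<b _ _ = contradiction (Equivalence.to (digit-≤⇔ j<n)
                       (subst (_≤ n * a + n) eq (ℕ.+-monoʳ-≤ (n * a) i<n))) (ℕ.<⇒≱ a<b)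
... | tri≈ _ refl _ = refl , ℕ.suc-injective (ℕ.+-cancelˡ-≡ (n * a) (suc i) (suc j) eq)
... | tri> _ _ b<a = contradiction (Equivalence.to (digit-≤⇔ i<n)
                       (subst (_≤ n * b + n) (sym eq) (ℕ.+-monoʳ-≤ (n * b) j<n))) (ℕ.<⇒≱ b<a)

code-injective : ∀ {n} (xs ys : List (Fin n)) → code xs ≡ code ys → xs ≡ ys
code-injective []       []       _  = refl
code-injective []       (y ∷ ys) eq = contradiction (sym eq) (ℕ.m+1+n≢0 _)
code-injective (x ∷ xs) []       eq = contradiction eq (ℕ.m+1+n≢0 _)
code-injective (x ∷ xs) (y ∷ ys) eq with digit-injective (toℕ<n x) (toℕ<n y) eq
... | codes≡ , digits≡ = cong₂ _∷_ (toℕ-injective digits≡) (code-injective xs ys codes≡)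

code-<-cons : ∀ {n} (v : Fin n) vs → code vs < code (v ∷ vs)
code-<-cons {suc k} v vs = begin-strict
  code vs                         ≤⟨ ℕ.m≤n*m (code vs) (suc k) ⟩
  suc k * code vs                 <⟨ ℕ.m<m+n (suc k * code vs) (s≤s z≤n) ⟩
  suc k * code vs + suc (toℕ v)   ∎
  where open ℕ.≤-Reasoning

code≤scaled : ∀ {n} (v : Fin n) vs → code (v ∷ vs) ≤ n * code (v ∷ vs) + n
code≤scaled {suc k} v vs = ℕ.≤-trans (ℕ.m≤n*m _ (suc k)) (ℕ.m≤m+n _ (suc k))

codeReach : ∀ {n} → Fin n → List (Fin n) → Reach
codeReach {n} v vs = reach (suc (code vs)) (code (v ∷ vs)) (n * code (v ∷ vs) + n)
  (code-<-cons v vs) (code≤scaled v vs)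

covers-codeReach⇔ : ∀ {n} (v w : Fin n) vs ws →
                    Covers (codeReach v vs) (codeReach w ws) ⇔
                    (code vs < code (w ∷ ws) × code ws ≤ code (v ∷ vs))
covers-codeReach⇔ v w vs ws = ⇔.refl ×-⇔ digit-≤⇔ (toℕ<n w)

codeReach-adj⇔ : ∀ {n} (v w : Fin n) vs ws →
                 CoverAdj (codeReach v vs) (codeReach w ws) ⇔ (ws ≡ v ∷ vs ⊎ vs ≡ w ∷ ws)
codeReach-adj⇔ v w vs ws =
  ⇔.trans (xor-cong (covers-codeReach⇔ v w vs ws) (covers-codeReach⇔ w v ws vs))
  (⇔.trans (xor-interleave⇔ (code-<-cons v vs) (code-<-cons w ws))
           (mk⇔ (code-injective _ _) (cong code) ⊎-⇔ mk⇔ (code-injective _ _) (cong code)))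

module _ {A : Set} where

  lastOf-++ : ∀ (x : A) xs y ys → lastOf x (xs ++ y ∷ ys) ≡ lastOf y ys
  lastOf-++ x []       y ys = refl
  lastOf-++ x (z ∷ xs) y ys = lastOf-++ z xs y ys

  lastOf-split : ∀ (x : A) xs B {u} C → x ∷ xs ≡ B ++ u ∷ C → lastOf x xs ≡ lastOf u C
  lastOf-split x xs []      C refl = refl
  lastOf-split x xs (b ∷ B) C refl = lastOf-++ x B _ C

  lastOf-∈ : ∀ (x : A) xs → lastOf x xs ∈ x ∷ xs
  lastOf-∈ x []       = here refl
  lastOf-∈ x (y ∷ xs) = there (lastOf-∈ y xs)

  unique-++⁻ˡ : ∀ xs {ys : List A} → Unique (xs ++ ys) → Unique xs
  unique-++⁻ˡ []       _        = []
  unique-++⁻ˡ (x ∷ xs) (x∉ ∷ u) = ++⁻ˡ xs x∉ ∷ unique-++⁻ˡ xs u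

  unique-++⁻ʳ : ∀ xs {ys : List A} → Unique (xs ++ ys) → Unique ys
  unique-++⁻ʳ []       u       = u
  unique-++⁻ʳ (x ∷ xs) (_ ∷ u) = unique-++⁻ʳ xs u

  module _ {R : A → A → Set} where

    linked-++⁻ˡ : ∀ xs {ys} → Linked R (xs ++ ys) → Linked R xs
    linked-++⁻ˡ []           _       = []
    linked-++⁻ˡ (x ∷ [])     _       = [-]
    linked-++⁻ˡ (x ∷ y ∷ xs) (r ∷ l) = r ∷ linked-++⁻ˡ (y ∷ xs) l

    linked-++⁻ʳ : ∀ xs {ys} → Linked R (xs ++ ys) → Linked R ys
    linked-++⁻ʳ []           l       = l
    linked-++⁻ʳ (x ∷ [])     {[]}    _       = []
    linked-++⁻ʳ (x ∷ [])     {y ∷ ys} (_ ∷ l) = l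
    linked-++⁻ʳ (x ∷ y ∷ xs) (_ ∷ l) = linked-++⁻ʳ (y ∷ xs) l

record SimplePath {n : ℕ} (E : Rel n) (x y : Fin n) : Set where
  field
    rest   : List (Fin n)
    unique : Unique (x ∷ rest)
    linked : Linked E (x ∷ rest)
    ends   : lastOf x rest ≡ y

open SimplePath

module _ {n : ℕ} {E : Rel n} where

  open DecMembership (_≟ᶠ_ {n}) using (_∈?_)

  suffixPath : ∀ {x y} (p : SimplePath E x y) A {u} B → x ∷ rest p ≡ A ++ u ∷ B → SimplePath E u y
  suffixPath p A B eq = record
    { rest   = B
    ; unique = unique-++⁻ʳ A (subst Unique eq (unique p))
    ; linked = linked-++⁻ʳ A (subst (Linked E) eq (linked p))
    ; ends   = trans (sym (lastOf-split _ (rest p) A B eq)) (ends p) }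

  walk⇒simplePath : ∀ {x y} → Walk E x y → SimplePath E x y
  walk⇒simplePath here = record { rest = [] ; unique = [] ∷ [] ; linked = [-] ; ends = refl }
  walk⇒simplePath {x} (step {w = w} e walk) with p ← walk⇒simplePath walk | x ∈? w ∷ rest p
  ... | no x∉ = record { rest = w ∷ rest p ; unique = ¬Any⇒All¬ _ x∉ ∷ unique p
                       ; linked = e ∷ linked p ; ends = ends p }
  ... | yes x∈ with A , B , eq ← ∈-∃++ x∈ = suffixPath p A B eq

module _ {n : ℕ} {E : Rel n} (symm : ∀ {i j} → E i j → E j i) (acyclic : ¬ HasCycle n E) where

  open DecMembership (_≟ᶠ_ {n}) using (_∈?_)

  private
    length-∷ʳ : ∀ (C : List (Fin n)) a → 1 ≤ length (C ++ [ a ])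
    length-∷ʳ []      a = s≤s z≤n
    length-∷ʳ (_ ∷ _) a = s≤s z≤n

    no-chord : ∀ x c C a → Unique (x ∷ c ∷ C ++ [ a ]) → Linked E (x ∷ c ∷ C ++ [ a ]) → ¬ E x a
    no-chord x c C a u l e = acyclic (x , c ∷ C ++ [ a ] , s≤s (length-∷ʳ C a) , u , l ,
      subst (λ z → E z x) (sym (lastOf-++ x (c ∷ C) a [])) (symm e))

  rest-unique : ∀ x xs ys → Unique (x ∷ xs) → Linked E (x ∷ xs) → Unique (x ∷ ys) → Linked E (x ∷ ys) →
                lastOf x xs ≡ lastOf x ys → xs ≡ ys
  rest-unique x []       []       _        _ _        _ _      = refl
  rest-unique x []       (b ∷ ys) _        _ (x∉ ∷ _) _ x≡last =
    contradiction x≡last (lookup x∉ (lastOf-∈ b ys))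
  rest-unique x (a ∷ xs) []       (x∉ ∷ _) _ _        _ last≡x =
    contradiction (sym last≡x) (lookup x∉ (lastOf-∈ a xs))
  rest-unique x (a ∷ xs) (b ∷ ys) (x∉a∷xs ∷ uxs) (exa ∷ lxs) uy@(_ ∷ uys) ly@(_ ∷ lys) last≡
    with a ≟ᶠ b
  ... | yes refl = cong (a ∷_) (rest-unique a xs ys uxs lxs uys lys last≡)
  ... | no a≢b with a ∈? b ∷ ys
  ...   | no a∉ = contradiction refl (lookup x∉a∷xs (there (subst (x ∈_) (sym xs≡) (here refl))))
    where
    a≢x : a ≢ x
    a≢x a≡x = lookup x∉a∷xs (here refl) (sym a≡x)
    xs≡ : xs ≡ x ∷ b ∷ ys
    xs≡ = rest-unique a xs (x ∷ b ∷ ys) uxs lxs ((a≢x ∷ ¬Any⇒All¬ _ a∉) ∷ uy) (symm exa ∷ ly) last≡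
  ...   | yes a∈ with ∈-∃++ a∈
  ...     | [] , D , eq = contradiction (sym (∷-injectiveˡ eq)) a≢b
  ...     | c ∷ C , D , eq = contradiction exa (no-chord x c C a
                                (unique-++⁻ˡ (x ∷ c ∷ C ++ [ a ]) (subst Unique eq′ uy))
                                (linked-++⁻ˡ (x ∷ c ∷ C ++ [ a ]) (subst (Linked E) eq′ ly)))
    where
    eq′ : x ∷ b ∷ ys ≡ (x ∷ c ∷ C ++ [ a ]) ++ D
    eq′ = cong (x ∷_) (trans eq (cong (c ∷_) (sym (++-assoc C [ a ] D))))

  simplePath-unique : ∀ {x y} (p q : SimplePath E x y) → rest p ≡ rest q
  simplePath-unique p q = rest-unique _ (rest p) (rest q) (unique p) (linked p) (unique q) (linked q)
                                      (trans (ends p) (sym (ends q)))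

  module _ {r : Fin n} (toRoot : ∀ v → SimplePath E v r) where

    rootPath : Fin n → List (Fin n)
    rootPath v = rest (toRoot v)

    private
      rootPath-extend : ∀ {u w} → E w u → w ∉ u ∷ rootPath u → rootPath w ≡ u ∷ rootPath u
      rootPath-extend {u} {w} e w∉ = simplePath-unique (toRoot w) record
        { rest = u ∷ rootPath u ; unique = ¬Any⇒All¬ _ w∉ ∷ unique (toRoot u)
        ; linked = e ∷ linked (toRoot u) ; ends = ends (toRoot u) }

      -- If each of u, w lies on the other's path, the part of u's path after w is w's path, so u repeats.
      not-mutually-on-path : ∀ {u w} → u ≢ w → w ∈ u ∷ rootPath u → u ∈ w ∷ rootPath w → ⊥
      not-mutually-on-path {u} {w} u≢w w∈ u∈ with ∈-∃++ w∈
      ... | [] , D , eq = u≢w (∷-injectiveˡ eq)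
      ... | _ ∷ A , D , eq with u∈
      ...   | here u≡w = u≢w u≡w
      ...   | there u∈path = Unique[x∷xs]⇒x∉xs (unique (toRoot u))
                               (subst (u ∈_) (sym (∷-injectiveʳ eq)) (∈-++⁺ʳ A (there u∈D)))
        where
        u∈D : u ∈ D
        u∈D = subst (u ∈_) (simplePath-unique (toRoot w) (suffixPath (toRoot u) (_ ∷ A) D eq)) u∈path

    edge⇔parent : ∀ {u w} → u ≢ w →
                  E u w ⇔ (rootPath w ≡ u ∷ rootPath u ⊎ rootPath u ≡ w ∷ rootPath w)
    edge⇔parent {u} {w} u≢w = mk⇔ to from
      where
      to : E u w → rootPath w ≡ u ∷ rootPath u ⊎ rootPath u ≡ w ∷ rootPath w
      to e with w ∈? u ∷ rootPath u | u ∈? w ∷ rootPath w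
      ... | no w∉  | _      = inj₁ (rootPath-extend (symm e) w∉)
      ... | yes _  | no u∉  = inj₂ (rootPath-extend e u∉)
      ... | yes w∈ | yes u∈ = ⊥-elim (not-mutually-on-path u≢w w∈ u∈)
      from : rootPath w ≡ u ∷ rootPath u ⊎ rootPath u ≡ w ∷ rootPath w → E u w
      from (inj₁ eq) = symm (head (subst (λ zs → Linked E (w ∷ zs)) eq (linked (toRoot w))))
      from (inj₂ eq) = head (subst (λ zs → Linked E (u ∷ zs)) eq (linked (toRoot u)))

tree : (n : ℕ) (G : Graph n) → IsTree n G → IsSAIGraph n (Graph.Adj G)
tree (suc n) G (_ , connected , acyclic) =
  reach-representation (λ v → codeReach v (path v)) λ u w u≢w →
    ⇔.trans (edge⇔parent (Graph.symm G) acyclic toRoot u≢w) (⇔.sym (codeReach-adj⇔ u w (path u) (path w)))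
  where
  toRoot : ∀ v → SimplePath (Graph.Adj G) v zero
  toRoot v = walk⇒simplePath (connected v zero)
  path : Fin (suc n) → List (Fin (suc n))
  path = rest ∘ toRoot

theorem23 : ((n : ℕ) → 1 ≤ n → IsSAIGraph n (CompleteAdj n))
    × ((n : ℕ) → 3 ≤ n → IsSAIGraph n (CycleAdj n))
    × ((n : ℕ) → 3 ≤ n → IsSAIGraph (suc n) (WheelAdj n))
    × ((n : ℕ) (G : Graph n) → IsTree n G → IsSAIGraph n (Graph.Adj G))
    × ((n k : ℕ) (p : Fin n → Fin k) → IsSAIGraph n (MultipartiteAdj n k p))
theorem23 = (λ n _ → complete n)
          , (λ n → cycle n ∘ ℕ.≤-trans (ℕ.n≤1+n 2))
          , (λ n → wheel n ∘ ℕ.≤-trans (ℕ.n≤1+n 2))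
          , tree
          , multipartite
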